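{- Let $G$ be an edge-colored complete graph and $t$ a positive integer. Let $R$ be a set of colors, let $U \subset V(G)$ with a partition $U = U_1 \cup \cdots \cup U_m$, let $c_1,\dots,c_m$ be pairwise distinct colors not in $R$ with $c_i$ associated to $U_i$, and suppose some of the edges of $G[U]$ are oriented so that: (a) for any edge between $x \in U_i$ and $y \in U_j$ with $i \neq j$: if it is directed from $x$ to $y$ its color is $c_i$, if it is directed from $y$ to $x$ its color is $c_j$, and if it is undirected its color is in $R$; (b) for any $x \in U_i$ and $y \in U_j$ (where $i$ may equal $j$) there exist at least $t$ vertices $z \notin U$ such that the edge $xz$ has color $c_i$ and the edge $yz$ has color $c_j$. Suppose we have a collection of $r < t$ edges $u_1v_1, \dots, u_rv_r$ of $G[U]$ whose colors are pairwise distinct members of $R$, and a collection of directed paths $P_0, P_1, \dots, P_r$ in $G[U]$ (each following the orientation of its edges), with $P_i$ starting at $v_i$ for $i \geq 1$. If no two of the vertices in $\{u_1, \dots, u_r\} \cup V(P_0) \cup \cdots \cup V(P_r)$ belong to the same set $U_j$, then there exists a rainbow path in $G$ that contains all of the paths $P_0,\dots,P_r$ and all of the edges $u_1v_1,\dots,u_rv_r$.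
   Context: A path in an edge-colored graph is rainbow if all its edges have pairwise distinct colors. A directed path $x_0x_1\cdots x_k$ is one in which each edge $x_{i-1}x_i$ is oriented from $x_{i-1}$ to $x_i$. -}

module Defs where

open import Data.Nat using (ℕ; suc)
open import Data.Fin using (Fin; zero; suc)
open import Data.Maybe using (Maybe; just; nothing)
open import Data.List using (List; []; _∷_; _++_; reverse; tabulate; concat; map)
open import Data.List.Relation.Unary.Unique.Propositional using (Unique)
open import Data.List.Relation.Unary.Linked using (Linked)
open import Data.List.Relation.Unary.All using (All)
open import Data.Product using (Σ; ∃; _×_)
open import Data.Sum using (_⊎_)
open import Relation.Binary.PropositionalEquality using (_≡_; _≢_)
open import Relation.Nullary using (¬_)
open import Function.Definitions using (Injective)

-- An edge colouring of the complete graph K_n: a symmetric map on pairs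
-- (values on the diagonal are irrelevant and never used).
record EdgeColouring (n : ℕ) : Set where
  field
    col  : Fin n → Fin n → ℕ
    symm : ∀ x y → col x y ≡ col y x
open EdgeColouring public

edgeColours : ∀ {n} → (Fin n → Fin n → ℕ) → List (Fin n) → List ℕ
edgeColours c []           = []
edgeColours c (x ∷ [])     = []
edgeColours c (x ∷ y ∷ xs) = c x y ∷ edgeColours c (y ∷ xs)

-- A path in the complete graph: a sequence of pairwise distinct vertices.
IsPath : ∀ {n} → List (Fin n) → Set
IsPath xs = Unique xs

IsRainbowPath : ∀ {n} → EdgeColouring n → List (Fin n) → Set
IsRainbowPath G xs = IsPath xs × Unique (edgeColours (col G) xs)

ContainsPath : ∀ {n} → List (Fin n) → List (Fin n) → Set
ContainsPath Q P =
  ∃ λ as → ∃ λ bs → (Q ≡ as ++ P ++ bs) ⊎ (Q ≡ as ++ reverse P ++ bs)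

ContainsEdge : ∀ {n} → List (Fin n) → Fin n → Fin n → Set
ContainsEdge Q u v =
  ∃ λ as → ∃ λ bs → (Q ≡ as ++ u ∷ v ∷ bs) ⊎ (Q ≡ as ++ v ∷ u ∷ bs)

-- U ⊆ V(G) with partition U = U_1 ∪ ... ∪ U_m is encoded by
-- part : Fin n → Maybe (Fin m):  x ∈ U_i  iff  part x ≡ just i,
-- and x ∉ U iff part x ≡ nothing.
InU : ∀ {n m} → (Fin n → Maybe (Fin m)) → Fin n → Set
InU part x = ∃ λ i → part x ≡ just i

-- The set-up of the lemma: colouring G, parameter t, colour set R,
-- partition `part`, colours c_i, orientation D (D x y : edge xy is
-- oriented from x to y), satisfying the hypotheses (a), (b).
record Setup {n m : ℕ} (G : EdgeColouring n) (t : ℕ) (R : ℕ → Set)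
             (part : Fin n → Maybe (Fin m)) (c : Fin m → ℕ)
             (D : Fin n → Fin n → Set) : Set where
  field
    c-injective : Injective _≡_ _≡_ c
    c-notInR    : ∀ i → ¬ R (c i)
    D-inU₁      : ∀ {x y} → D x y → InU part x
    D-inU₂      : ∀ {x y} → D x y → InU part y
    D-asym      : ∀ {x y} → D x y → ¬ D y x
    cond-a-out  : ∀ {x y i j} → part x ≡ just i → part y ≡ just j → i ≢ j →
                  D x y → col G x y ≡ c i
    cond-a-in   : ∀ {x y i j} → part x ≡ just i → part y ≡ just j → i ≢ j →
                  D y x → col G x y ≡ c j
    cond-a-und  : ∀ {x y i j} → part x ≡ just i → part y ≡ just j → i ≢ j →
                  ¬ D x y → ¬ D y x → R (col G x y)
    -- (b): at least t (distinct) vertices z ∉ U with col x z = c_i, col y z = c_j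
    cond-b      : ∀ {x y i j} → part x ≡ just i → part y ≡ just j →
                  Σ (Fin t → Fin n) λ f → Injective _≡_ _≡_ f ×
                    (∀ k → part (f k) ≡ nothing × col G x (f k) ≡ c i
                                                 × col G y (f k) ≡ c j)

IsDirPathInU : ∀ {n m} → (Fin n → Maybe (Fin m)) → (Fin n → Fin n → Set) →
               List (Fin n) → Set
IsDirPathInU part D P = P ≢ [] × Unique P × All (InU part) P × Linked D P

allListedVertices : ∀ {n r} → (Fin r → Fin n) → (Fin (suc r) → List (Fin n)) →
                    List (Fin n)
allListedVertices u P = tabulate u ++ concat (tabulate P)

module Submission where

-- For r = 0 the directed path P₀ itself is the
-- required path.  For r ≥ 1 drop u₁v₁ and P₀, and let Q' be the path obtained for
-- the remaining data; Q' begins with P₁, hence with v₁.  Let y be the last vertex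
-- of P₀.  By (b) there are t vertices z ∉ U with col(yz) = c(y) and col(zu₁) = c(u₁)
-- (c(x), written κ x below, is the colour of the class of x); only r - 1 < t of them occur on Q', so
-- one of them, z, is new and  Q = P₀ z u₁ Q'  is the required path.
--
-- By (a) every edge of a directed path carries the colour of the class of its tail.
-- Hence the colours of Q are drawn, without repetition, from the palette
--   c(listed vertices) ++ (colours of the edges uₖvₖ),
-- which itself has no repetitions; likewise the vertices of Q are drawn from the
-- listed vertices together with the connectors z used so far.

open import Defs
open import Data.Nat using (ℕ; suc; _<_)
open import Data.Fin using (Fin; zero; suc)
open import Data.Maybe using (Maybe; just; nothing)
open import Data.List using (List; _∷_; map)
open import Data.List.Relation.Unary.Unique.Propositional using (Unique)
open import Data.Product using (Σ; ∃; _×_)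
open import Relation.Binary.PropositionalEquality using (_≡_; _≢_)
open import Function.Definitions using (Injective)

open import Data.List using ([]; _++_; length; tabulate; last; lookup)
open import Data.List.Properties using (++-assoc; ++-identityʳ; map-++)
open import Data.Nat.Properties using (<-trans; n<1+n)
open import Data.Fin.Properties using (suc-injective; pigeonhole; ¬∀⟶∃¬; <⇒≢; _≟_)
open import Data.Product using (_,_; proj₁; proj₂)
open import Data.Sum as Sum using (inj₁)
open import Data.Empty using (⊥-elim)
open import Function using (_∘_)
open import Relation.Nullary using (¬_)
open import Relation.Binary.Definitions using (Symmetric)
open import Relation.Binary.PropositionalEquality
  using (refl; sym; trans; cong; cong₂; subst; setoid; module ≡-Reasoning)
open import Data.List.Relation.Unary.All as All using (All; []; _∷_)
import Data.List.Relation.Unary.All.Properties as All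
open import Data.List.Relation.Unary.AllPairs as AllPairs using (AllPairs; []; _∷_)
import Data.List.Relation.Unary.AllPairs.Properties as AllPairs
open import Data.List.Relation.Unary.Linked using (Linked; []; [-]; _∷_)
open import Data.List.Relation.Unary.Any as Any using (here; there; index)
open import Data.List.Relation.Unary.Any.Properties using (lookup-index)
import Data.List.Relation.Unary.Unique.Propositional.Properties as Unique
open import Data.List.Membership.Propositional using (_∈_; _∉_)
open import Data.List.Membership.Propositional.Properties
  using (∈-++⁺ˡ; ∈-map⁻; ∈-tabulate⁻)
open import Data.List.Relation.Binary.Subset.Propositional using (_⊆_)
import Data.List.Relation.Binary.Subset.Propositional.Properties as Subset
open import Data.List.Relation.Binary.Permutation.Propositional
  using (_↭_; ↭-refl; ↭-prep; ↭-swap; ↭-sym; ↭⇒↭ₛ; module PermutationReasoning)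
import Data.List.Relation.Binary.Permutation.Propositional.Properties as Perm
import Data.List.Relation.Binary.Permutation.Setoid.Properties as PermSetoid

module _ {A : Set} where

  DrawnFrom : List A → List A → Set
  DrawnFrom pool xs = Unique xs × xs ⊆ pool

  allPairs-prefix : ∀ {R : A → A → Set} xs {ys} → AllPairs R (xs ++ ys) → AllPairs R xs
  allPairs-prefix []       _          = []
  allPairs-prefix (x ∷ xs) (px ∷ pxs) = All.++⁻ˡ xs px ∷ allPairs-prefix xs pxs

  allPairs-suffix : ∀ {R : A → A → Set} xs {ys} → AllPairs R (xs ++ ys) → AllPairs R ys
  allPairs-suffix []       pys       = pys
  allPairs-suffix (x ∷ xs) (_ ∷ pxs) = allPairs-suffix xs pxs

  allPairs-upgrade : ∀ {P : A → Set} {R S : A → A → Set} →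
                     (∀ {x y} → P x → P y → R x y → S x y) →
                     ∀ {xs} → All P xs → AllPairs R xs → AllPairs S xs
  allPairs-upgrade f []         []         = []
  allPairs-upgrade f (px ∷ pxs) (rx ∷ rxs) =
    All.zipWith (λ (py , r) → f px py r) (pxs , rx) ∷ allPairs-upgrade f pxs rxs

  allPairs-resp-↭ : ∀ {R : A → A → Set} → Symmetric R →
                    ∀ {xs ys} → xs ↭ ys → AllPairs R xs → AllPairs R ys
  allPairs-resp-↭ {R} R-sym σ =
    PermSetoid.AllPairs-resp-↭ (setoid A) R-sym (respʳ , respˡ) (↭⇒↭ₛ σ)
    where
    respʳ : ∀ {x y z} → y ≡ z → R x y → R x z
    respʳ refl r = r
    respˡ : ∀ {x y z} → y ≡ z → R y x → R z x
    respˡ refl r = r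

  unique-replace : ∀ (xs : List A) {ys zs : List A} → Unique (xs ++ ys) → Unique zs → zs ⊆ ys →
                   Unique (xs ++ zs)
  unique-replace []       _            zs! _     = zs!
  unique-replace (x ∷ xs) (x∉ ∷ xsys!) zs! zs⊆ys =
    All.++⁺ (All.++⁻ˡ xs x∉)
            (All.tabulate (λ w∈zs → All.lookup (All.++⁻ʳ xs x∉) (zs⊆ys w∈zs)))
    ∷ unique-replace xs xsys! zs! zs⊆ys

  -- If the duplicate-free pool is a rearrangement of xs ++ ys, then xs followed by
  -- any list drawn from ys is drawn from the pool: the induction step of both
  -- invariants of the construction.
  drawn-extend : ∀ {pool xs ys zs : List A} → Unique pool → pool ↭ xs ++ ys →
                 DrawnFrom ys zs → DrawnFrom pool (xs ++ zs)
  drawn-extend {xs = xs} pool! σ (zs! , zs⊆ys) =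
    unique-replace xs (allPairs-resp-↭ (λ ne → ne ∘ sym) σ pool!) zs! zs⊆ys ,
    Perm.∈-resp-↭ (↭-sym σ) ∘ Subset.++⁺ʳ xs zs⊆ys

  drawn-prefix : ∀ {pool} (xs : List A) {ws} → DrawnFrom pool (xs ++ ws) → DrawnFrom pool xs
  drawn-prefix xs (xsws! , xsws⊆) = allPairs-prefix xs xsws! , xsws⊆ ∘ ∈-++⁺ˡ

  regroup : ∀ a b (B C E : List A) →
            (a ∷ B ++ C) ++ b ∷ E ↭ (B ++ a ∷ b ∷ []) ++ (C ++ E)
  regroup a b B C E = begin
    (a ∷ B ++ C) ++ b ∷ E       ≡⟨ cong (a ∷_) (++-assoc B C (b ∷ E)) ⟩
    a ∷ B ++ C ++ b ∷ E         ↭⟨ ↭-prep a (Perm.++⁺ˡ B (Perm.shift b C E)) ⟩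
    a ∷ B ++ b ∷ C ++ E         ↭⟨ ↭-sym (Perm.shift a B (b ∷ C ++ E)) ⟩
    B ++ a ∷ b ∷ C ++ E         ≡⟨ ++-assoc B (a ∷ b ∷ []) (C ++ E) ⟨
    (B ++ a ∷ b ∷ []) ++ (C ++ E) ∎
    where open PermutationReasoning

  last-∈ : ∀ {y : A} xs → last xs ≡ just y → y ∈ xs
  last-∈ (x ∷ [])      refl = here refl
  last-∈ (x ∷ x' ∷ xs) eq   = there (last-∈ (x' ∷ xs) eq)

  last-exists : ∀ (xs : List A) → xs ≢ [] → ∃ λ y → last xs ≡ just y
  last-exists []            xs≢[] = ⊥-elim (xs≢[] refl)
  last-exists (x ∷ [])      _     = x , refl
  last-exists (x ∷ x' ∷ xs) _     = last-exists (x' ∷ xs) (λ ())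

  prefix-shift : ∀ pre {Q as X : List A} → Q ≡ as ++ X → pre ++ Q ≡ (pre ++ as) ++ X
  prefix-shift pre {as = as} {X} eq = trans (cong (pre ++_) eq) (sym (++-assoc pre as X))

module _ {n : ℕ} (col : Fin n → Fin n → ℕ) where

  edgeColours-++ : ∀ xs {y} ys → last xs ≡ just y →
                   edgeColours col (xs ++ ys) ≡ edgeColours col xs ++ edgeColours col (y ∷ ys)
  edgeColours-++ (x ∷ [])      ys refl = refl
  edgeColours-++ (x ∷ x' ∷ xs) ys eq   = cong (col x x' ∷_) (edgeColours-++ (x' ∷ xs) ys eq)

  edgeColours-cons : ∀ a {Q b rest} → Q ≡ b ∷ rest →
                     edgeColours col (a ∷ Q) ≡ col a b ∷ edgeColours col Q
  edgeColours-cons a refl = refl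

  tail-coloured : ∀ (κ : Fin n → ℕ) xs {y} → Linked (λ a b → col a b ≡ κ a) xs →
                  last xs ≡ just y → edgeColours col xs ++ κ y ∷ [] ≡ map κ xs
  tail-coloured κ (x ∷ [])      [-]          refl = refl
  tail-coloured κ (x ∷ x' ∷ xs) (col≡ ∷ lnk) eq   =
    cong₂ _∷_ col≡ (tail-coloured κ (x' ∷ xs) lnk eq)

  joined-colours : ∀ (κ : Fin n → ℕ) xs {y z a b Q' rest} →
                   Linked (λ p q → col p q ≡ κ p) xs → last xs ≡ just y →
                   col y z ≡ κ y → col z a ≡ κ a → Q' ≡ b ∷ rest →
                   edgeColours col (xs ++ z ∷ a ∷ Q') ≡
                   (map κ xs ++ κ a ∷ col a b ∷ []) ++ edgeColours col Q'
  joined-colours κ xs {y} {z} {a} {b} {Q'} lnk last≡ yz za Q'≡ = begin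
    edgeColours col (xs ++ z ∷ a ∷ Q')
      ≡⟨ edgeColours-++ xs (z ∷ a ∷ Q') last≡ ⟩
    edgeColours col xs ++ col y z ∷ col z a ∷ edgeColours col (a ∷ Q')
      ≡⟨ cong (edgeColours col xs ++_)
              (cong₂ _∷_ yz (cong₂ _∷_ za (edgeColours-cons a Q'≡))) ⟩
    edgeColours col xs ++ κ y ∷ κ a ∷ col a b ∷ edgeColours col Q'
      ≡⟨ ++-assoc (edgeColours col xs) (κ y ∷ []) _ ⟨
    (edgeColours col xs ++ κ y ∷ []) ++ κ a ∷ col a b ∷ edgeColours col Q'
      ≡⟨ cong (_++ _) (tail-coloured κ xs lnk last≡) ⟩
    map κ xs ++ κ a ∷ col a b ∷ edgeColours col Q'
      ≡⟨ ++-assoc (map κ xs) (κ a ∷ col a b ∷ []) _ ⟨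
    (map κ xs ++ κ a ∷ col a b ∷ []) ++ edgeColours col Q' ∎
    where open ≡-Reasoning

module _ {n : ℕ} where

  containsPath-++ˡ : ∀ pre {Q X : List (Fin n)} → ContainsPath Q X → ContainsPath (pre ++ Q) X
  containsPath-++ˡ pre (as , bs , eq) =
    pre ++ as , bs , Sum.map (prefix-shift pre) (prefix-shift pre) eq

  containsEdge-++ˡ : ∀ pre {Q : List (Fin n)} {a b} → ContainsEdge Q a b →
                     ContainsEdge (pre ++ Q) a b
  containsEdge-++ˡ pre (as , bs , eq) =
    pre ++ as , bs , Sum.map (prefix-shift pre) (prefix-shift pre) eq

  injection-escapes : ∀ {t} (f : Fin t → Fin n) → Injective _≡_ _≡_ f →
                      (zs : List (Fin n)) → length zs < t → ∃ λ k → f k ∉ zs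
  injection-escapes {t} f f-inj zs short =
    ¬∀⟶∃¬ t (λ k → f k ∈ zs) (λ k → Any.any? (f k ≟_) zs) all-hit
    where
    all-hit : ¬ (∀ k → f k ∈ zs)
    all-hit hit with pigeonhole short (λ k → index (hit k))
    ... | i , j , i<j , same-index =
      <⇒≢ i<j (f-inj (trans (lookup-index (hit i))
                     (trans (cong (lookup zs) same-index) (sym (lookup-index (hit j))))))

  listed-split : ∀ {r} (u : Fin (suc r) → Fin n) (P : Fin (suc (suc r)) → List (Fin n)) →
                 allListedVertices u P ↭
                 u zero ∷ P zero ++ allListedVertices (u ∘ suc) (P ∘ suc)
  listed-split u P = ↭-prep (u zero) (Perm.shifts (tabulate (u ∘ suc)) (P zero))

module Construction {n m : ℕ} (G : EdgeColouring n) (t : ℕ) (R : ℕ → Set)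
  (part : Fin n → Maybe (Fin m)) (c : Fin m → ℕ) (D : Fin n → Fin n → Set)
  (setup : Setup G t R part c D) where

  open Setup setup

  Apart : Fin n → Fin n → Set
  Apart x y = part x ≢ part y

  Outside : Fin n → Set
  Outside z = part z ≡ nothing

  inU-not-outside : ∀ {x} → InU part x → ¬ Outside x
  inU-not-outside (i , eq) out with trans (sym eq) out
  ... | ()

  -- The colour c_i attached to class i (the value 0 outside U is never used).
  classColour : Maybe (Fin m) → ℕ
  classColour (just i) = c i
  classColour nothing  = 0

  κ : Fin n → ℕ
  κ x = classColour (part x)

  κ-class : ∀ {x i} → part x ≡ just i → κ x ≡ c i
  κ-class = cong classColour

  classes-differ : ∀ {x y i j} → part x ≡ just i → part y ≡ just j → Apart x y → i ≢ j
  classes-differ ei ej apart refl = apart (trans ei (sym ej))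

  κ-apart : ∀ {x y} → InU part x → InU part y → Apart x y → κ x ≢ κ y
  κ-apart (i , ei) (j , ej) apart κ≡ =
    classes-differ ei ej apart (c-injective (trans (sym (κ-class ei)) (trans κ≡ (κ-class ej))))

  κ-notInR : ∀ {x} → InU part x → ¬ R (κ x)
  κ-notInR (i , ei) Rκ = c-notInR i (subst R (κ-class ei) Rκ)

  κ-unique : ∀ {xs} → All (InU part) xs → AllPairs Apart xs → Unique (map κ xs)
  κ-unique inU apart = AllPairs.map⁺ (allPairs-upgrade κ-apart inU apart)

  directed-colour : ∀ {x y} → D x y → Apart x y → col G x y ≡ κ x
  directed-colour dxy apart with D-inU₁ dxy | D-inU₂ dxy
  ... | i , ei | j , ej =
    trans (cond-a-out ei ej (classes-differ ei ej apart) dxy) (sym (κ-class ei))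

  directed-tail-coloured : ∀ {xs} → Linked D xs → AllPairs Apart xs →
                           Linked (λ a b → col G a b ≡ κ a) xs
  directed-tail-coloured []          _                  = []
  directed-tail-coloured [-]         _                  = [-]
  directed-tail-coloured (dxy ∷ lnk) ((apart ∷ _) ∷ ap) =
    directed-colour dxy apart ∷ directed-tail-coloured lnk ap

  connector : ∀ {y x} → InU part y → InU part x → (used : List (Fin n)) → length used < t →
              ∃ λ z → Outside z × z ∉ used × col G y z ≡ κ y × col G z x ≡ κ x
  connector {x = x} (i , ei) (j , ej) used short with cond-b ei ej
  ... | f , f-inj , f-good with injection-escapes f f-inj used short
  ... | k , new with f-good k
  ... | out , yz , xz =
    f k , out , new , trans yz (sym (κ-class ei)) ,
    trans (symm G (f k) x) (trans xz (sym (κ-class ej)))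

  record Config (r : ℕ) : Set where
    field
      u v          : Fin r → Fin n
      P            : Fin (suc r) → List (Fin n)
      u-inU        : ∀ k → InU part (u k)
      uv-inR       : ∀ k → R (col G (u k) (v k))
      uv-rainbow   : Injective _≡_ _≡_ (λ k → col G (u k) (v k))
      P-directed   : ∀ i → IsDirPathInU part D (P i)
      P-start      : ∀ k → ∃ λ rest → P (suc k) ≡ v k ∷ rest
      listed-apart : AllPairs Apart (allListedVertices u P)

    ρ : Fin r → ℕ
    ρ k = col G (u k) (v k)

    listed : List (Fin n)
    listed = allListedVertices u P

    palette : List ℕ
    palette = map κ listed ++ tabulate ρ

    P-nonempty : ∀ i → P i ≢ []
    P-nonempty = proj₁ ∘ P-directed

    P-unique : ∀ i → Unique (P i)
    P-unique = proj₁ ∘ proj₂ ∘ P-directed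

    P-inU : ∀ i → All (InU part) (P i)
    P-inU = proj₁ ∘ proj₂ ∘ proj₂ ∘ P-directed

    P-linked : ∀ i → Linked D (P i)
    P-linked = proj₂ ∘ proj₂ ∘ proj₂ ∘ P-directed

    listed-inU : All (InU part) listed
    listed-inU = All.++⁺ (All.tabulate⁺ u-inU) (All.concat⁺ (All.tabulate⁺ P-inU))

    P₀-apart : AllPairs Apart (P zero)
    P₀-apart = allPairs-prefix (P zero) (allPairs-suffix (tabulate u) listed-apart)

    P₀-coloured : Linked (λ a b → col G a b ≡ κ a) (P zero)
    P₀-coloured = directed-tail-coloured (P-linked zero) P₀-apart

    P₀-last : ∃ λ y → last (P zero) ≡ just y
    P₀-last = last-exists (P zero) (P-nonempty zero)

    -- Class colours of distinct classes differ, the ρ k differ, and the former avoid R.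
    palette-unique : Unique palette
    palette-unique = Unique.++⁺ (κ-unique listed-inU listed-apart)
                                (Unique.tabulate⁺ uv-rainbow) κ-not-ρ
      where
      κ-not-ρ : ∀ {w} → ¬ (w ∈ map κ listed × w ∈ tabulate ρ)
      κ-not-ρ (w∈κ , w∈ρ) with ∈-map⁻ κ w∈κ | ∈-tabulate⁻ w∈ρ
      ... | x , x∈ , refl | k , eq =
        κ-notInR (All.lookup listed-inU x∈) (subst R (sym eq) (uv-inR k))

    pool-unique : ∀ {zs} → All Outside zs → Unique zs → Unique (listed ++ zs)
    pool-unique out zs! =
      Unique.++⁺ (AllPairs.map (λ apart → apart ∘ cong part) listed-apart) zs!
        (λ (x∈L , x∈Z) → inU-not-outside (All.lookup listed-inU x∈L) (All.lookup out x∈Z))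

  open Config

  tail : ∀ {r} → Config (suc r) → Config r
  tail C = record
    { u = u C ∘ suc ; v = v C ∘ suc ; P = P C ∘ suc
    ; u-inU = u-inU C ∘ suc ; uv-inR = uv-inR C ∘ suc
    ; uv-rainbow = suc-injective ∘ uv-rainbow C
    ; P-directed = P-directed C ∘ suc ; P-start = P-start C ∘ suc
    ; listed-apart = allPairs-suffix (P C zero) (AllPairs.tail
        (allPairs-resp-↭ (λ apart → apart ∘ sym) (listed-split (u C) (P C)) (listed-apart C)))
    }

  pool-split : ∀ {r} (C : Config (suc r)) z zs →
               listed C ++ z ∷ zs ↭
               (P C zero ++ z ∷ u C zero ∷ []) ++ (listed (tail C) ++ zs)
  pool-split C z zs = begin
    listed C ++ z ∷ zs              ↭⟨ Perm.++⁺ʳ (z ∷ zs) (listed-split (u C) (P C)) ⟩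
    (u₀ ∷ P₀ ++ L') ++ z ∷ zs       ↭⟨ regroup u₀ z P₀ L' zs ⟩
    (P₀ ++ u₀ ∷ z ∷ []) ++ (L' ++ zs)
      ↭⟨ Perm.++⁺ʳ (L' ++ zs) (Perm.++⁺ˡ P₀ (↭-swap u₀ z ↭-refl)) ⟩
    (P₀ ++ z ∷ u₀ ∷ []) ++ (L' ++ zs) ∎
    where
    open PermutationReasoning
    u₀ : Fin n
    u₀ = u C zero
    P₀ L' : List (Fin n)
    P₀ = P C zero
    L' = listed (tail C)

  palette-split : ∀ {r} (C : Config (suc r)) →
                  palette C ↭ (map κ (P C zero) ++ κ (u C zero) ∷ ρ C zero ∷ []) ++ palette (tail C)
  palette-split C = begin
    map κ (listed C) ++ ρ₀ ∷ ρs
      ↭⟨ Perm.++⁺ʳ (ρ₀ ∷ ρs) (Perm.map⁺ κ (listed-split (u C) (P C))) ⟩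
    map κ (u₀ ∷ P₀ ++ L') ++ ρ₀ ∷ ρs
      ≡⟨ cong (λ cs → (κ u₀ ∷ cs) ++ ρ₀ ∷ ρs) (map-++ κ P₀ L') ⟩
    (κ u₀ ∷ map κ P₀ ++ map κ L') ++ ρ₀ ∷ ρs
      ↭⟨ regroup (κ u₀) ρ₀ (map κ P₀) (map κ L') ρs ⟩
    (map κ P₀ ++ κ u₀ ∷ ρ₀ ∷ []) ++ palette (tail C) ∎
    where
    open PermutationReasoning
    u₀ : Fin n
    u₀ = u C zero
    P₀ L' : List (Fin n)
    P₀ = P C zero
    L' = listed (tail C)
    ρ₀ : ℕ
    ρ₀ = ρ C zero
    ρs : List ℕ
    ρs = tabulate (ρ (tail C))

  record Route {r} (C : Config r) : Set where
    field
      Q                  : List (Fin n)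
      connectors         : List (Fin n)
      connectors-outside : All Outside connectors
      connectors-unique  : Unique connectors
      connectors-count   : length connectors ≡ r
      starts             : ∃ λ rest → Q ≡ P C zero ++ rest
      vertices           : DrawnFrom (listed C ++ connectors) Q
      colours            : DrawnFrom (palette C) (edgeColours (col G) Q)
      paths              : ∀ i → ContainsPath Q (P C i)
      edges              : ∀ k → ContainsEdge Q (u C k) (v C k)

  route₀ : (C : Config 0) → Route C
  route₀ C = record
    { Q = P₀ ; connectors = [] ; connectors-outside = [] ; connectors-unique = []
    ; connectors-count = refl
    ; starts = [] , sym (++-identityʳ P₀)
    ; vertices = P-unique C zero , ∈-++⁺ˡ ∘ ∈-++⁺ˡ
    ; colours = drawn-prefix (edgeColours (col G) P₀)
                  (subst (DrawnFrom (palette C)) (sym colours≡) κ-drawn)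
    ; paths = λ { zero → [] , [] , inj₁ (sym (++-identityʳ P₀)) }
    ; edges = λ ()
    }
    where
    P₀ : List (Fin n)
    P₀ = P C zero
    colours≡ : edgeColours (col G) P₀ ++ κ (proj₁ (P₀-last C)) ∷ [] ≡ map κ P₀
    colours≡ = tail-coloured (col G) κ P₀ (P₀-coloured C) (proj₂ (P₀-last C))
    κ-drawn : DrawnFrom (palette C) (map κ P₀)
    κ-drawn = κ-unique (P-inU C zero) (P₀-apart C)
            , ∈-++⁺ˡ ∘ Subset.map⁺ κ (Subset.xs⊆xs++ys P₀ [])

  extend-route : ∀ {r} (C : Config (suc r)) (route' : Route (tail C)) {y z : Fin n} →
                 last (P C zero) ≡ just y → Outside z → z ∉ Route.connectors route' →
                 col G y z ≡ κ y → col G z (u C zero) ≡ κ (u C zero) → Route C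
  extend-route C route' {z = z} last≡ z-out z-new yz zu = record
    { Q = Q
    ; connectors = z ∷ R'.connectors
    ; connectors-outside = z-out ∷ R'.connectors-outside
    ; connectors-unique = connectors-unique
    ; connectors-count = cong suc R'.connectors-count
    ; starts = z ∷ u₀ ∷ R'.Q , refl
    ; vertices = subst (DrawnFrom _) Q≡
        (drawn-extend (pool-unique C (z-out ∷ R'.connectors-outside) connectors-unique)
                      (pool-split C z R'.connectors) R'.vertices)
    ; colours = subst (DrawnFrom (palette C))
        (sym (joined-colours (col G) κ P₀ (P₀-coloured C) last≡ yz zu (proj₂ Q'-start)))
        (drawn-extend (palette-unique C) (palette-split C) R'.colours)
    ; paths = λ { zero → [] , z ∷ u₀ ∷ R'.Q , inj₁ refl
                ; (suc i) → subst (λ q → ContainsPath q (P C (suc i))) Q≡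
                                  (containsPath-++ˡ (P₀ ++ z ∷ u₀ ∷ []) (R'.paths i)) }
    ; edges = λ { zero → P₀ ++ z ∷ [] , proj₁ Q'-start ,
                         inj₁ (prefix-shift P₀ (cong (λ q → z ∷ u₀ ∷ q) (proj₂ Q'-start)))
                ; (suc k) → subst (λ q → ContainsEdge q (u C (suc k)) (v C (suc k))) Q≡
                                  (containsEdge-++ˡ (P₀ ++ z ∷ u₀ ∷ []) (R'.edges k)) }
    }
    where
    module R' = Route route'
    u₀ : Fin n
    u₀ = u C zero
    P₀ Q : List (Fin n)
    P₀ = P C zero
    Q = P₀ ++ z ∷ u₀ ∷ R'.Q
    Q≡ : (P₀ ++ z ∷ u₀ ∷ []) ++ R'.Q ≡ Q
    Q≡ = ++-assoc P₀ (z ∷ u₀ ∷ []) R'.Q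
    connectors-unique : Unique (z ∷ R'.connectors)
    connectors-unique = All.¬Any⇒All¬ R'.connectors z-new ∷ R'.connectors-unique
    -- Q' begins with P₁, which begins with v₀.
    Q'-start : ∃ λ rest → R'.Q ≡ v C zero ∷ rest
    Q'-start with R'.starts | P-start C zero
    ... | tl , Q'≡ | rest , P₁≡ = rest ++ tl , trans Q'≡ (cong (_++ tl) P₁≡)

  -- Q' uses only r < t connectors, so one of the t candidates of (b) is new.
  route-step : ∀ {r} (C : Config (suc r)) → r < t → Route (tail C) → Route C
  route-step C r<t route' with P₀-last C
  ... | _ , last≡
    with connector (All.lookup (P-inU C zero) (last-∈ (P C zero) last≡)) (u-inU C zero)
                   (Route.connectors route')
                   (subst (_< t) (sym (Route.connectors-count route')) r<t)
  ... | z , z-out , z-new , yz , zu = extend-route C route' last≡ z-out z-new yz zu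

  route : ∀ r (C : Config r) → r < t → Route C
  route 0       C _     = route₀ C
  route (suc r) C short = route-step C r<t (route r (tail C) r<t)
    where
    r<t : r < t
    r<t = <-trans (n<1+n r) short

lemma2p3 : {n m : ℕ} (G : EdgeColouring n) (t : ℕ) → 0 < t →
    (R : ℕ → Set) (part : Fin n → Maybe (Fin m)) (c : Fin m → ℕ)
    (D : Fin n → Fin n → Set) → Setup G t R part c D →
    (r : ℕ) → r < t →
    (u v : Fin r → Fin n) →
    (∀ k → InU part (u k)) → (∀ k → InU part (v k)) → (∀ k → u k ≢ v k) →
    (∀ k → R (col G (u k) (v k))) →
    Injective _≡_ _≡_ (λ k → col G (u k) (v k)) →
    (P : Fin (suc r) → List (Fin n)) →
    (∀ i → IsDirPathInU part D (P i)) →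
    (∀ k → ∃ λ rest → P (suc k) ≡ v k ∷ rest) →
    Unique (map part (allListedVertices u P)) →
    ∃ λ (Q : List (Fin n)) → IsRainbowPath G Q
    × (∀ i → ContainsPath Q (P i))
    × (∀ k → ContainsEdge Q (u k) (v k))
lemma2p3 G t _ R part c D setup r r<t u v u-inU _ _ uv-inR uv-rainbow P P-directed P-start
         parts-unique =
  Q , (proj₁ vertices , proj₁ colours) , paths , edges
  where
  open Construction G t R part c D setup
  config : Config r
  config = record
    { u = u ; v = v ; P = P ; u-inU = u-inU ; uv-inR = uv-inR ; uv-rainbow = uv-rainbow
    ; P-directed = P-directed ; P-start = P-start
    ; listed-apart = AllPairs.map⁻ parts-unique
    }
  open Route (route r config r<t)
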